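{- Let $P\colon\mathcal{C}^{op}\to\mathbf{DLat}$ be a $\{\land,\lor\}$-doctrine with existential completion $P^\exists$ as described in the context. Then $P^\exists\colon\mathcal{C}^{op}\to\mathbf{DLat}$ is a $\{\exists,\land,\lor\}$-doctrine.
   Context: A $\{\land,\lor\}$-doctrine is a functor $P\colon\mathcal{C}^{op}\to\mathbf{DLat}$ ($\mathcal{C}$ with finite products, $\mathbf{DLat}$ distributive lattices and lattice homomorphisms); $f^\ast=P(f)$; $\pi_d\colon d\times c\to c$ is the projection forgetting $d$. It is a $\{\exists,\land,\lor\}$-doctrine if each $\pi_d^\ast\colon P(c)\to P(d\times c)$ has a left adjoint $\Sigma_d$ satisfying Frobenius ($x\land\Sigma_d y=\Sigma_d(\pi_d^\ast x\land y)$) and Beck–Chevalley ($f^\ast\Sigma_d=\Sigma_d(1_d\times f)^\ast$ for all $f\colon c'\to c$). The completion: $P^\exists(c)$ is the posetal reflection of the preorder of finite sets $\{(d_1,x_1),\dots,(d_n,x_n)\}$ ($d_i\in\mathcal{C}$, $x_i\in P(d_i\times c)$) with $\{(d_i,x_i)\}_{i\le n}\le\{(e_j,y_j)\}_{j\le m}$ iff for each $i$ there are arrows $r_\ell\colon d_i\times c\to e_{j_\ell}\times c$ ($\ell=1,\dots,k$, $j_\ell\le m$) with $\pi_{e_{j_\ell}}\circ r_\ell=\pi_{d_i}$ and $x_i\le r_1^\ast y_{j_1}\lor\dots\lor r_k^\ast y_{j_k}$; for $f\colon c'\to c$, $P^\exists(f)$ sends $\{(d_i,x_i)\}$ to $\{(d_i,(1_{d_i}\times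 f)^\ast x_i)\}$. -}

module Defs where

open import Level using (Level; _⊔_) renaming (suc to lsuc)
open import Data.Product using (Σ; Σ-syntax; _×_; _,_)
open import Data.List using (List)
import Data.List as List
open import Data.List.NonEmpty using (List⁺; foldr₁)
import Data.List.NonEmpty as List⁺
open import Data.List.Membership.Propositional using (_∈_)
open import Relation.Binary.PropositionalEquality using (_≡_)
open import Relation.Binary.Core using (Rel)
open import Relation.Binary.Lattice.Structures using (IsDistributiveLattice)

record Category (o h : Level) : Set (lsuc (o ⊔ h)) where
  infixr 9 _∘_
  field
    Obj  : Set o
    Hom  : Obj → Obj → Set h
    id   : ∀ {a} → Hom a a
    _∘_  : ∀ {a b c} → Hom b c → Hom a b → Hom a c
    identityˡ : ∀ {a b} (f : Hom a b) → id ∘ f ≡ f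
    identityʳ : ∀ {a b} (f : Hom a b) → f ∘ id ≡ f
    assoc     : ∀ {a b c d} (f : Hom a b) (g : Hom b c) (k : Hom c d) →
                (k ∘ g) ∘ f ≡ k ∘ (g ∘ f)

record FiniteProducts {o h : Level} (C : Category o h) : Set (o ⊔ h) where
  open Category C
  infixr 7 _⊗_
  field
    𝟙        : Obj
    !        : ∀ {a} → Hom a 𝟙
    !-unique : ∀ {a} (f : Hom a 𝟙) → f ≡ !
    _⊗_      : Obj → Obj → Obj
    π₁       : ∀ {a b} → Hom (a ⊗ b) a
    π₂       : ∀ {a b} → Hom (a ⊗ b) b
    ⟨_,_⟩    : ∀ {x a b} → Hom x a → Hom x b → Hom x (a ⊗ b)
    π₁-⟨⟩    : ∀ {x a b} (f : Hom x a) (g : Hom x b) → π₁ ∘ ⟨ f , g ⟩ ≡ f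
    π₂-⟨⟩    : ∀ {x a b} (f : Hom x a) (g : Hom x b) → π₂ ∘ ⟨ f , g ⟩ ≡ g
    ⟨⟩-unique : ∀ {x a b} (f : Hom x a) (g : Hom x b) (k : Hom x (a ⊗ b)) →
                π₁ ∘ k ≡ f → π₂ ∘ k ≡ g → k ≡ ⟨ f , g ⟩

  1×_ : ∀ {d c c'} → Hom c' c → Hom (d ⊗ c') (d ⊗ c)
  1× f = ⟨ π₁ , f ∘ π₂ ⟩

module _ {o h : Level} (C : Category o h) (FP : FiniteProducts C) where
  open Category C
  open FiniteProducts FP

  record IsDoctrine {p ℓ : Level} (F : Obj → Set p)
                    (_≈_ : ∀ {c} → Rel (F c) ℓ)
                    (_≤_ : ∀ {c} → Rel (F c) ℓ)
                    (re  : ∀ {c c'} → Hom c' c → F c → F c')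
                    : Set (o ⊔ h ⊔ p ⊔ ℓ) where
    field
      _∨_   : ∀ {c} → F c → F c → F c
      _∧_   : ∀ {c} → F c → F c → F c
      isDistributiveLattice : ∀ {c} → IsDistributiveLattice (_≈_ {c}) _≤_ _∨_ _∧_
      re-cong : ∀ {c c'} (f : Hom c' c) {x y : F c} → x ≈ y → re f x ≈ re f y
      re-∨    : ∀ {c c'} (f : Hom c' c) (x y : F c) → re f (x ∨ y) ≈ (re f x ∨ re f y)
      re-∧    : ∀ {c c'} (f : Hom c' c) (x y : F c) → re f (x ∧ y) ≈ (re f x ∧ re f y)
      re-id   : ∀ {c} (x : F c) → re id x ≈ x
      re-∘    : ∀ {a b c} (f : Hom a b) (g : Hom b c) (x : F c) →
                re (g ∘ f) x ≈ re f (re g x)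

  record Doctrine (p ℓ : Level) : Set (o ⊔ h ⊔ lsuc (p ⊔ ℓ)) where
    field
      F   : Obj → Set p
      _≈_ : ∀ {c} → Rel (F c) ℓ
      _≤_ : ∀ {c} → Rel (F c) ℓ
      re  : ∀ {c c'} → Hom c' c → F c → F c'
      isDoctrine : IsDoctrine F _≈_ _≤_ re
    open IsDoctrine isDoctrine public

  record IsExistential {p ℓ : Level} {F : Obj → Set p}
                       {_≈_ : ∀ {c} → Rel (F c) ℓ}
                       {_≤_ : ∀ {c} → Rel (F c) ℓ}
                       {re  : ∀ {c c'} → Hom c' c → F c → F c'}
                       (D : IsDoctrine F _≈_ _≤_ re)
                       : Set (o ⊔ h ⊔ p ⊔ ℓ) where
    open IsDoctrine D
    field
      Σᵈ : ∀ d {c} → F (d ⊗ c) → F c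
      adjunction : ∀ d {c} (y : F (d ⊗ c)) (x : F c) →
                   (Σᵈ d y ≤ x → y ≤ re π₂ x) × (y ≤ re π₂ x → Σᵈ d y ≤ x)
      frobenius : ∀ d {c} (x : F c) (y : F (d ⊗ c)) →
                  (x ∧ Σᵈ d y) ≈ Σᵈ d (re π₂ x ∧ y)
      beck-chevalley : ∀ d {c c'} (f : Hom c' c) (y : F (d ⊗ c)) →
                       re f (Σᵈ d y) ≈ Σᵈ d (re (1× f) y)

  module Completion {p ℓ : Level} (P : Doctrine p ℓ) where
    open Doctrine P

    F∃ : Obj → Set (o ⊔ p)
    F∃ c = List (Σ[ d ∈ Obj ] F (d ⊗ c))

    record Witness {c} (ys : F∃ c) (d : Obj) : Set (o ⊔ h ⊔ p) where
      constructor witness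
      field
        e    : Obj
        y    : F (e ⊗ c)
        mem  : (e , y) ∈ ys
        r    : Hom (d ⊗ c) (e ⊗ c)
        over : π₂ ∘ r ≡ π₂

    term : ∀ {c} {ys : F∃ c} {d} → Witness ys d → F (d ⊗ c)
    term w = re (Witness.r w) (Witness.y w)

    ⋁ : ∀ {c} {ys : F∃ c} {d} → List⁺ (Witness ys d) → F (d ⊗ c)
    ⋁ ws = foldr₁ _∨_ (List⁺.map term ws)

    _≤∃_ : ∀ {c} → Rel (F∃ c) (o ⊔ h ⊔ p ⊔ ℓ)
    xs ≤∃ ys = ∀ {d x} → (d , x) ∈ xs →
               Σ[ ws ∈ List⁺ (Witness ys d) ] (x ≤ ⋁ ws)

    _≈∃_ : ∀ {c} → Rel (F∃ c) (o ⊔ h ⊔ p ⊔ ℓ)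
    xs ≈∃ ys = (xs ≤∃ ys) × (ys ≤∃ xs)

    re∃ : ∀ {c c'} → Hom c' c → F∃ c → F∃ c'
    re∃ f = List.map (λ { (d , x) → d , re (1× f) x })

{-# OPTIONS --safe #-}
-- An element of P^∃(c) is a finite disjunction of formal existentials ∃d.x (atoms). The lattice
-- operations are syntactic: joins concatenate, and the meet of ∃d.x and ∃e.y is ∃(d×e).(x ∧ y),
-- so distributivity is a list identity up to commutativity of meets. Reindexing along f and the
-- quantifier Σ_d, which rebrackets ∃e.y over d×c into ∃(e×d).y over c, both act atom by atom, and
-- they are monotone because every arrow over the base that witnesses the order lifts along them.
-- All other laws (functoriality, preservation of meets, unit and counit of Σ_d ⊣ π*,
-- Beck–Chevalley, one half of Frobenius) already hold between corresponding atoms, each witnessed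
-- by a single arrow over the base; the other half of Frobenius follows from the adjunction.
module Submission where

open import Level using (Level; _⊔_)
open import Data.Product using (Σ-syntax; _,_; proj₁; proj₂; _×_)
open import Data.Sum using ([_,_]′)
open import Data.List using (List; []; _∷_; _++_; map; cartesianProductWith)
open import Data.List.Properties using (map-++; map-∘; map-id; cartesianProductWith-distribʳ-++)
open import Data.List.NonEmpty using (List⁺; _∷_; _⁺++⁺_)
open import Data.List.Membership.Propositional using (_∈_)
open import Data.List.Membership.Propositional.Properties
  using (∈-map⁺; ∈-map⁻; ∈-++⁺ˡ; ∈-++⁺ʳ; ∈-++⁻; ∈-cartesianProductWith⁺; ∈-cartesianProductWith⁻)
open import Data.List.Relation.Binary.Subset.Propositional using (_⊆_)
open import Relation.Binary.PropositionalEquality as ≡ using (_≡_; refl; sym; trans; cong; cong₂; module ≡-Reasoning)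
open import Relation.Binary.Bundles using (Preorder; Setoid)
open import Relation.Binary.Lattice.Bundles using (Lattice; DistributiveLattice)
open import Relation.Binary.Lattice.Structures using (IsLattice; IsDistributiveLattice)
import Relation.Binary.Lattice.Properties.JoinSemilattice as JoinSemilatticeProperties
import Relation.Binary.Lattice.Properties.MeetSemilattice as MeetSemilatticeProperties
import Relation.Binary.Lattice.Properties.DistributiveLattice as DistributiveLatticeProperties
import Relation.Binary.Properties.Preorder as PreorderProperties
import Relation.Binary.Reasoning.PartialOrder as PartialOrderReasoning
import Relation.Binary.Reasoning.Setoid as SetoidReasoning
open import Defs

map-cartesianProductWith : ∀ {a b c d} {A : Set a} {B : Set b} {C : Set c} {D : Set d}
  (g : C → D) (f : A → B → C) (xs : List A) (ys : List B) →
  map g (cartesianProductWith f xs ys) ≡ cartesianProductWith (λ x y → g (f x y)) xs ys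
map-cartesianProductWith g f []       ys = refl
map-cartesianProductWith g f (x ∷ xs) ys = begin
  map g (map (f x) ys ++ cartesianProductWith f xs ys)
    ≡⟨ map-++ g (map (f x) ys) _ ⟩
  map g (map (f x) ys) ++ map g (cartesianProductWith f xs ys)
    ≡⟨ cong₂ _++_ (sym (map-∘ ys)) (map-cartesianProductWith g f xs ys) ⟩
  map (λ y → g (f x y)) ys ++ cartesianProductWith (λ x y → g (f x y)) xs ys ∎
  where open ≡-Reasoning

cartesianProductWith-mapˡ : ∀ {a b c d} {A : Set a} {B : Set b} {C : Set c} {D : Set d}
  (f : C → B → D) (g : A → C) (xs : List A) (ys : List B) →
  cartesianProductWith f (map g xs) ys ≡ cartesianProductWith (λ x → f (g x)) xs ys
cartesianProductWith-mapˡ f g []       ys = refl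
cartesianProductWith-mapˡ f g (x ∷ xs) ys = cong (map (f (g x)) ys ++_) (cartesianProductWith-mapˡ f g xs ys)

cartesianProductWith-mapʳ : ∀ {a b c d} {A : Set a} {B : Set b} {C : Set c} {D : Set d}
  (f : A → C → D) (h : B → C) (xs : List A) (ys : List B) →
  cartesianProductWith f xs (map h ys) ≡ cartesianProductWith (λ x y → f x (h y)) xs ys
cartesianProductWith-mapʳ f h []       ys = refl
cartesianProductWith-mapʳ f h (x ∷ xs) ys = cong₂ _++_ (sym (map-∘ ys)) (cartesianProductWith-mapʳ f h xs ys)

module CartesianLemmas {o h : Level} (C : Category o h) (FP : FiniteProducts C) where
  open Category C
  open FiniteProducts FP
  open ≡-Reasoning

  _×1 : ∀ {a b c} → Hom a b → Hom (a ⊗ c) (b ⊗ c)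
  q ×1 = ⟨ q ∘ π₁ , π₂ ⟩

  assocˡ : ∀ {a b c} → Hom ((a ⊗ b) ⊗ c) (a ⊗ (b ⊗ c))
  assocˡ = ⟨ π₁ ∘ π₁ , ⟨ π₂ ∘ π₁ , π₂ ⟩ ⟩

  assocʳ : ∀ {a b c} → Hom (a ⊗ (b ⊗ c)) ((a ⊗ b) ⊗ c)
  assocʳ = ⟨ ⟨ π₁ , π₁ ∘ π₂ ⟩ , π₂ ∘ π₂ ⟩

  pullˡ : ∀ {a b c d} {f : Hom a b} {g : Hom b c} {k : Hom a c} {m : Hom d a} →
          g ∘ f ≡ k → g ∘ (f ∘ m) ≡ k ∘ m
  pullˡ {f = f} {g} {m = m} eq = trans (sym (assoc m f g)) (cong (_∘ m) eq)

  pullʳ : ∀ {a b c d} {f : Hom a b} {m : Hom d a} {k : Hom d b} {g : Hom b c} →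
          f ∘ m ≡ k → (g ∘ f) ∘ m ≡ g ∘ k
  pullʳ {f = f} {m} {g = g} eq = trans (assoc m f g) (cong (g ∘_) eq)

  ⟨⟩-η : ∀ {x a b} (k : Hom x (a ⊗ b)) → ⟨ π₁ ∘ k , π₂ ∘ k ⟩ ≡ k
  ⟨⟩-η k = sym (⟨⟩-unique _ _ k refl refl)

  ⟨π₁,π₂⟩≡id : ∀ {a b} → ⟨ π₁ , π₂ ⟩ ≡ id {a ⊗ b}
  ⟨π₁,π₂⟩≡id = sym (⟨⟩-unique π₁ π₂ id (identityʳ π₁) (identityʳ π₂))

  ⟨⟩∘ : ∀ {x y a b} {f : Hom y a} {g : Hom y b} {k : Hom x y} → ⟨ f , g ⟩ ∘ k ≡ ⟨ f ∘ k , g ∘ k ⟩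
  ⟨⟩∘ {f = f} {g} = ⟨⟩-unique _ _ _ (pullˡ (π₁-⟨⟩ f g)) (pullˡ (π₂-⟨⟩ f g))

  ×1∘⟨⟩ : ∀ {x a b c} {q : Hom a b} {u : Hom x a} {w : Hom x c} → (q ×1) ∘ ⟨ u , w ⟩ ≡ ⟨ q ∘ u , w ⟩
  ×1∘⟨⟩ {u = u} {w} = trans ⟨⟩∘ (cong₂ ⟨_,_⟩ (pullʳ (π₁-⟨⟩ u w)) (π₂-⟨⟩ u w))

  1×∘⟨⟩ : ∀ {x d c c'} {f : Hom c' c} {u : Hom x d} {v : Hom x c'} → (1× f) ∘ ⟨ u , v ⟩ ≡ ⟨ u , f ∘ v ⟩
  1×∘⟨⟩ {u = u} {v} = trans ⟨⟩∘ (cong₂ ⟨_,_⟩ (π₁-⟨⟩ u v) (pullʳ (π₂-⟨⟩ u v)))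

  assocˡ∘⟨⟩ : ∀ {x a b c} {u : Hom x (a ⊗ b)} {w : Hom x c} →
              assocˡ ∘ ⟨ u , w ⟩ ≡ ⟨ π₁ ∘ u , ⟨ π₂ ∘ u , w ⟩ ⟩
  assocˡ∘⟨⟩ {u = u} {w} =
    trans ⟨⟩∘ (cong₂ ⟨_,_⟩ (pullʳ (π₁-⟨⟩ u w))
                          (trans ⟨⟩∘ (cong₂ ⟨_,_⟩ (pullʳ (π₁-⟨⟩ u w)) (π₂-⟨⟩ u w))))

  1×-id : ∀ {d c} → 1×_ {d} (id {c}) ≡ id
  1×-id = trans (cong₂ ⟨_,_⟩ refl (identityˡ π₂)) ⟨π₁,π₂⟩≡id

  1×-∘ : ∀ {d c c' c''} (g : Hom c' c) (f : Hom c'' c') → (1× g) ∘ (1× f) ≡ 1×_ {d} (g ∘ f)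
  1×-∘ g f = trans 1×∘⟨⟩ (cong₂ ⟨_,_⟩ refl (sym (assoc π₂ f g)))

  ×1-∘ : ∀ {a b b' c} {q : Hom b b'} {q' : Hom a b} → (q ×1) ∘ (q' ×1) ≡ _×1 {c = c} (q ∘ q')
  ×1-∘ {q = q} {q'} = trans ×1∘⟨⟩ (cong₂ ⟨_,_⟩ (sym (assoc π₁ q' q)) refl)

  ×1-1×-comm : ∀ {a b c c'} {q : Hom a b} {f : Hom c' c} → (q ×1) ∘ (1× f) ≡ (1× f) ∘ (q ×1)
  ×1-1×-comm = trans ×1∘⟨⟩ (sym 1×∘⟨⟩)

  over-η : ∀ {d e c} {r : Hom (d ⊗ c) (e ⊗ c)} → π₂ ∘ r ≡ π₂ → ⟨ π₁ ∘ r , π₂ ⟩ ≡ r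
  over-η {r = r} over = trans (cong₂ ⟨_,_⟩ refl (sym over)) (⟨⟩-η r)

  assocˡ∘assocʳ : ∀ {a b c} → assocˡ ∘ assocʳ ≡ id {a ⊗ (b ⊗ c)}
  assocˡ∘assocʳ = begin
    assocˡ ∘ assocʳ
      ≡⟨ assocˡ∘⟨⟩ ⟩
    ⟨ π₁ ∘ ⟨ π₁ , π₁ ∘ π₂ ⟩ , ⟨ π₂ ∘ ⟨ π₁ , π₁ ∘ π₂ ⟩ , π₂ ∘ π₂ ⟩ ⟩
      ≡⟨ cong₂ ⟨_,_⟩ (π₁-⟨⟩ _ _) (cong₂ ⟨_,_⟩ (π₂-⟨⟩ _ _) refl) ⟩
    ⟨ π₁ , ⟨ π₁ ∘ π₂ , π₂ ∘ π₂ ⟩ ⟩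
      ≡⟨ cong₂ ⟨_,_⟩ refl (⟨⟩-η π₂) ⟩
    ⟨ π₁ , π₂ ⟩
      ≡⟨ ⟨π₁,π₂⟩≡id ⟩
    id ∎

  assocˡ∘1× : ∀ {a b c c'} {f : Hom c' c} → assocˡ {a} {b} ∘ (1× f) ≡ (1× (1× f)) ∘ assocˡ
  assocˡ∘1× {f = f} = begin
    assocˡ ∘ ⟨ π₁ , f ∘ π₂ ⟩                  ≡⟨ assocˡ∘⟨⟩ ⟩
    ⟨ π₁ ∘ π₁ , ⟨ π₂ ∘ π₁ , f ∘ π₂ ⟩ ⟩        ≡⟨ cong₂ ⟨_,_⟩ refl (sym 1×∘⟨⟩) ⟩
    ⟨ π₁ ∘ π₁ , (1× f) ∘ ⟨ π₂ ∘ π₁ , π₂ ⟩ ⟩  ≡⟨ sym 1×∘⟨⟩ ⟩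
    (1× (1× f)) ∘ assocˡ                      ∎

  ×1∘assocˡ : ∀ {a a' b c} {q : Hom a a'} → (q ×1) ∘ assocˡ {b = b} {c} ≡ assocˡ ∘ ((q ×1) ×1)
  ×1∘assocˡ {q = q} = begin
    (q ×1) ∘ assocˡ
      ≡⟨ ×1∘⟨⟩ ⟩
    ⟨ q ∘ (π₁ ∘ π₁) , ⟨ π₂ ∘ π₁ , π₂ ⟩ ⟩
      ≡⟨ cong₂ ⟨_,_⟩ (sym (trans (pullˡ (π₁-⟨⟩ _ _)) (assoc π₁ π₁ q)))
                     (cong₂ ⟨_,_⟩ (sym (pullˡ (π₂-⟨⟩ _ _))) refl) ⟩
    ⟨ π₁ ∘ ((q ×1) ∘ π₁) , ⟨ π₂ ∘ ((q ×1) ∘ π₁) , π₂ ⟩ ⟩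
      ≡⟨ sym assocˡ∘⟨⟩ ⟩
    assocˡ ∘ ((q ×1) ×1) ∎

  1×π₂∘assocˡ : ∀ {a b c} → (1× π₂) ∘ assocˡ {a} {b} {c} ≡ π₁ ×1
  1×π₂∘assocˡ = trans 1×∘⟨⟩ (cong₂ ⟨_,_⟩ refl (π₂-⟨⟩ _ _))

  π₂×1∘assocʳ : ∀ {a b c} → (π₂ ×1) ∘ assocʳ {a} {b} {c} ≡ π₂
  π₂×1∘assocʳ = trans ×1∘⟨⟩ (trans (cong₂ ⟨_,_⟩ (π₂-⟨⟩ _ _) refl) (⟨⟩-η π₂))

  1×π₂∘π₁×1∘assocˡ∘assocʳ×1 : ∀ {a b d c} →
    ((1× π₂) ∘ (π₁ ×1)) ∘ (assocˡ ∘ _×1 {c = c} (assocʳ {a} {b} {d})) ≡ π₁ ×1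
  1×π₂∘π₁×1∘assocˡ∘assocʳ×1 = begin
    ((1× π₂) ∘ (π₁ ×1)) ∘ (assocˡ ∘ (assocʳ ×1))  ≡⟨ cong (_∘ (assocˡ ∘ (assocʳ ×1))) (sym ×1-1×-comm) ⟩
    ((π₁ ×1) ∘ (1× π₂)) ∘ (assocˡ ∘ (assocʳ ×1))  ≡⟨ pullʳ (pullˡ 1×π₂∘assocˡ) ⟩
    (π₁ ×1) ∘ ((π₁ ×1) ∘ (assocʳ ×1))              ≡⟨ cong ((π₁ ×1) ∘_) ×1-∘ ⟩
    (π₁ ×1) ∘ ((π₁ ∘ assocʳ) ×1)                   ≡⟨ ×1-∘ ⟩
    (π₁ ∘ (π₁ ∘ assocʳ)) ×1                        ≡⟨ cong _×1 (trans (cong (π₁ ∘_) (π₁-⟨⟩ _ _)) (π₁-⟨⟩ _ _)) ⟩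
    π₁ ×1                                          ∎

  π₂×1∘assocˡ∘assocʳ×1 : ∀ {a b d c} →
    (π₂ ×1) ∘ (assocˡ ∘ _×1 {c = c} (assocʳ {a} {b} {d})) ≡ assocˡ ∘ (π₂ ×1)
  π₂×1∘assocˡ∘assocʳ×1 = begin
    (π₂ ×1) ∘ (assocˡ ∘ (assocʳ ×1))  ≡⟨ pullˡ ×1∘assocˡ ⟩
    (assocˡ ∘ ((π₂ ×1) ×1)) ∘ (assocʳ ×1)  ≡⟨ pullʳ ×1-∘ ⟩
    assocˡ ∘ (((π₂ ×1) ∘ assocʳ) ×1)  ≡⟨ cong (λ q → assocˡ ∘ (q ×1)) π₂×1∘assocʳ ⟩
    assocˡ ∘ (π₂ ×1)                  ∎

  1×-lift : ∀ {d e c c'} {r : Hom (d ⊗ c) (e ⊗ c)} {f : Hom c' c} → π₂ ∘ r ≡ π₂ →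
            r ∘ (1× f) ≡ (1× f) ∘ ⟨ π₁ ∘ (r ∘ (1× f)) , π₂ ⟩
  1×-lift {r = r} {f} over = begin
    r ∘ (1× f)                                     ≡⟨ sym (⟨⟩-η _) ⟩
    ⟨ π₁ ∘ (r ∘ (1× f)) , π₂ ∘ (r ∘ (1× f)) ⟩      ≡⟨ cong₂ ⟨_,_⟩ refl (trans (pullˡ over) (π₂-⟨⟩ _ _)) ⟩
    ⟨ π₁ ∘ (r ∘ (1× f)) , f ∘ π₂ ⟩                 ≡⟨ sym 1×∘⟨⟩ ⟩
    (1× f) ∘ ⟨ π₁ ∘ (r ∘ (1× f)) , π₂ ⟩            ∎

  assoc-conjugate-over : ∀ {e e' d c} {r : Hom (e ⊗ (d ⊗ c)) (e' ⊗ (d ⊗ c))} → π₂ ∘ r ≡ π₂ →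
                π₂ ∘ (assocʳ ∘ (r ∘ assocˡ)) ≡ π₂
  assoc-conjugate-over {r = r} over = begin
    π₂ ∘ (assocʳ ∘ (r ∘ assocˡ))  ≡⟨ pullˡ (π₂-⟨⟩ _ _) ⟩
    (π₂ ∘ π₂) ∘ (r ∘ assocˡ)      ≡⟨ pullʳ (pullˡ over) ⟩
    π₂ ∘ (π₂ ∘ assocˡ)            ≡⟨ cong (π₂ ∘_) (π₂-⟨⟩ _ _) ⟩
    π₂ ∘ ⟨ π₂ ∘ π₁ , π₂ ⟩         ≡⟨ π₂-⟨⟩ _ _ ⟩
    π₂                            ∎

  cancelˡ : ∀ {a b c} {f : Hom a b} {g : Hom b a} {m : Hom c a} → g ∘ f ≡ id → g ∘ (f ∘ m) ≡ m
  cancelˡ {m = m} eq = trans (pullˡ eq) (identityˡ m)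

module ExistentialCompletion {o h p ℓ : Level} (C : Category o h) (FP : FiniteProducts C)
                             (P : Doctrine C FP p ℓ) where
  open Category C
  open FiniteProducts FP
  open Doctrine P
  open Completion C FP P
  open CartesianLemmas C FP

  fibre : Obj → DistributiveLattice p ℓ ℓ
  fibre c = record { isDistributiveLattice = isDistributiveLattice {c} }

  module Fibre {c : Obj} where
    open DistributiveLattice (fibre c) public
      using (refl; trans; reflexive; module Eq; x∧y≤x; x∧y≤y; ∧-greatest; ∧-distribˡ-∨)
    open JoinSemilatticeProperties (DistributiveLattice.joinSemilattice (fibre c)) public
      using (∨-monotonic; ∨-assoc)
    open MeetSemilatticeProperties (DistributiveLattice.meetSemilattice (fibre c)) public
      using (∧-monotonic; ∧-cong; y≤x⇒x∧y≈y)
    open DistributiveLatticeProperties (fibre c) public using (∧-distribʳ-∨)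

  module ≈-Reasoning {c : Obj} = SetoidReasoning (DistributiveLattice.setoid (fibre c))

  re-≡ : ∀ {c c'} {f g : Hom c' c} {x : F c} → f ≡ g → re f x ≈ re g x
  re-≡ refl = Fibre.Eq.refl

  re-path : ∀ {a b c} {f : Hom a b} {g : Hom b c} {k : Hom a c} {x : F c} →
            g ∘ f ≡ k → re f (re g x) ≈ re k x
  re-path {f = f} {g} {x = x} eq = Fibre.Eq.trans (Fibre.Eq.sym (re-∘ f g x)) (re-≡ eq)

  re-square : ∀ {a b b' c} {f : Hom a b} {g : Hom b c} {f' : Hom a b'} {g' : Hom b' c} {x : F c} →
              g ∘ f ≡ g' ∘ f' → re f (re g x) ≈ re f' (re g' x)
  re-square eq = Fibre.Eq.trans (re-path eq) (Fibre.Eq.sym (re-path refl))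

  re-mono : ∀ {c c'} (f : Hom c' c) {x y : F c} → x ≤ y → re f x ≤ re f y
  re-mono f {x} {y} x≤y = Fibre.trans
    (Fibre.reflexive (Fibre.Eq.trans (re-cong f (Fibre.Eq.sym (Fibre.y≤x⇒x∧y≈y x≤y))) (re-∧ f y x)))
    (Fibre.x∧y≤x _ _)

  re-∨≤ : ∀ {c c'} (f : Hom c' c) (x y : F c) → re f (x ∨ y) ≤ (re f x ∨ re f y)
  re-∨≤ f x y = Fibre.reflexive (re-∨ f x y)

  Atom : Obj → Set (o ⊔ p)
  Atom c = Σ[ d ∈ Obj ] F (d ⊗ c)

  _⊑_ : ∀ {c} → Atom c → Atom c → Set (h ⊔ ℓ)
  _⊑_ {c} (d , x) (e , y) = Σ[ r ∈ Hom (d ⊗ c) (e ⊗ c) ] (π₂ ∘ r ≡ π₂) × (x ≤ re r y)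

  _≋_ : ∀ {c} → Atom c → Atom c → Set (h ⊔ ℓ)
  a ≋ b = (a ⊑ b) × (b ⊑ a)

  ≤⇒⊑ : ∀ {c d} {x y : F (d ⊗ c)} → x ≤ y → (d , x) ⊑ (d , y)
  ≤⇒⊑ {y = y} x≤y = id , identityʳ π₂ , Fibre.trans x≤y (Fibre.reflexive (Fibre.Eq.sym (re-id y)))

  ≈⇒≋ : ∀ {c d} {x y : F (d ⊗ c)} → x ≈ y → (d , x) ≋ (d , y)
  ≈⇒≋ x≈y = ≤⇒⊑ (Fibre.reflexive x≈y) , ≤⇒⊑ (Fibre.reflexive (Fibre.Eq.sym x≈y))

  Cover : ∀ {c d} → F∃ c → F (d ⊗ c) → Set (o ⊔ h ⊔ p ⊔ ℓ)
  Cover {d = d} ys x = Σ[ ws ∈ List⁺ (Witness ys d) ] x ≤ ⋁ ws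

  cover-member : ∀ {c d} {ys : F∃ c} {x : F (d ⊗ c)} {b : Atom c} → b ∈ ys → (d , x) ⊑ b → Cover ys x
  cover-member {b = e , y} b∈ys (r , over , x≤ry) = witness e y b∈ys r over ∷ [] , x≤ry

  cover-≤ : ∀ {c d} {ys : F∃ c} {x x' : F (d ⊗ c)} → x ≤ x' → Cover ys x' → Cover ys x
  cover-≤ x≤x' (ws , x'≤⋁ws) = ws , Fibre.trans x≤x' x'≤⋁ws

  ⋁-++ : ∀ {c d} {ys : F∃ c} (ws vs : List⁺ (Witness ys d)) → (⋁ ws ∨ ⋁ vs) ≤ ⋁ (ws ⁺++⁺ vs)
  ⋁-++ {d = d} {ys} (w ∷ ws) vs = ⋁-∷-++ w ws
    where
    ⋁-∷-++ : (w : Witness ys d) (ws : List (Witness ys d)) → (⋁ (w ∷ ws) ∨ ⋁ vs) ≤ ⋁ ((w ∷ ws) ⁺++⁺ vs)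
    ⋁-∷-++ w []        = Fibre.refl
    ⋁-∷-++ w (w' ∷ ws) =
      Fibre.trans (Fibre.reflexive (Fibre.∨-assoc _ _ _)) (Fibre.∨-monotonic Fibre.refl (⋁-∷-++ w' ws))

  cover-∨ : ∀ {c d} {ys : F∃ c} {x x' : F (d ⊗ c)} → Cover ys x → Cover ys x' → Cover ys (x ∨ x')
  cover-∨ (ws , x≤) (vs , x'≤) = ws ⁺++⁺ vs , Fibre.trans (Fibre.∨-monotonic x≤ x'≤) (⋁-++ ws vs)

  cover-image : ∀ {c c' d d'} {ys : F∃ c} {zs : F∃ c'} (f : F (d ⊗ c) → F (d' ⊗ c')) →
                (∀ {x y} → x ≤ y → f x ≤ f y) → (∀ x y → f (x ∨ y) ≤ (f x ∨ f y)) →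
                ((w : Witness ys d) → Cover zs (f (term w))) →
                ∀ {x} → Cover ys x → Cover zs (f x)
  cover-image {d = d} {ys = ys} {zs} f f-mono f-∨ cover-term (w ∷ ws , x≤⋁ws) =
    cover-≤ (f-mono x≤⋁ws) (cover-⋁ w ws)
    where
    cover-⋁ : (w : Witness ys d) (ws : List (Witness ys d)) → Cover zs (f (⋁ (w ∷ ws)))
    cover-⋁ w []        = cover-term w
    cover-⋁ w (w' ∷ ws) = cover-≤ (f-∨ _ _) (cover-∨ (cover-term w) (cover-⋁ w' ws))

  cover-re : ∀ {c d e} {zs : F∃ c} {y : F (e ⊗ c)} (r : Hom (d ⊗ c) (e ⊗ c)) → π₂ ∘ r ≡ π₂ →
             Cover zs y → Cover zs (re r y)
  cover-re {zs = zs} r over = cover-image (re r) (re-mono r) (re-∨≤ r) cover-term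
    where
    cover-term : (w : Witness zs _) → Cover zs (re r (term w))
    cover-term (witness e y y∈zs r' over') =
      cover-member y∈zs (r' ∘ r , trans (pullˡ over') over , Fibre.reflexive (re-path refl))

  ≤∃-trans : ∀ {c} {xs ys zs : F∃ c} → xs ≤∃ ys → ys ≤∃ zs → xs ≤∃ zs
  ≤∃-trans {ys = ys} {zs} xs≤ys ys≤zs {d} x∈xs =
    cover-image (λ x → x) (λ x≤y → x≤y) (λ _ _ → Fibre.refl) cover-term (xs≤ys x∈xs)
    where
    cover-term : (w : Witness ys d) → Cover zs (term w)
    cover-term (witness e y y∈ys r over) = cover-re r over (ys≤zs y∈ys)

  ⊆⇒≤∃ : ∀ {c} {xs ys : F∃ c} → xs ⊆ ys → xs ≤∃ ys
  ⊆⇒≤∃ xs⊆ys x∈xs = cover-member (xs⊆ys x∈xs) (≤⇒⊑ Fibre.refl)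

  ≤∃-preorder : Obj → Preorder (o ⊔ p) (o ⊔ p) (o ⊔ h ⊔ p ⊔ ℓ)
  ≤∃-preorder c = record
    { Carrier    = F∃ c
    ; _≈_        = _≡_
    ; _≲_        = _≤∃_
    ; isPreorder = record
      { isEquivalence = ≡.isEquivalence
      ; reflexive     = λ { refl → ⊆⇒≤∃ (λ x∈xs → x∈xs) }
      ; trans         = ≤∃-trans
      }
    }

  ≈∃-setoid : Obj → Setoid (o ⊔ p) (o ⊔ h ⊔ p ⊔ ℓ)
  ≈∃-setoid c = PreorderProperties.InducedEquivalence (≤∃-preorder c)

  map-≤∃ : ∀ {a c} {A : Set a} (f g : A → Atom c) → (∀ x → f x ⊑ g x) → (xs : List A) →
           map f xs ≤∃ map g xs
  map-≤∃ f g f⊑g xs fx∈ with ∈-map⁻ f fx∈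
  ... | x , x∈xs , refl = cover-member (∈-map⁺ g x∈xs) (f⊑g x)

  map-≈∃ : ∀ {a c} {A : Set a} (f g : A → Atom c) → (∀ x → f x ≋ g x) → (xs : List A) →
           map f xs ≈∃ map g xs
  map-≈∃ f g f≋g xs = map-≤∃ f g (λ x → proj₁ (f≋g x)) xs , map-≤∃ g f (λ x → proj₂ (f≋g x)) xs

  cartesianProductWith-≤∃ : ∀ {a b c} {A : Set a} {B : Set b} (f g : A → B → Atom c) →
    (∀ x y → f x y ⊑ g x y) → (xs : List A) (ys : List B) →
    cartesianProductWith f xs ys ≤∃ cartesianProductWith g xs ys
  cartesianProductWith-≤∃ f g f⊑g xs ys fxy∈ with ∈-cartesianProductWith⁻ f xs ys fxy∈
  ... | x , y , x∈xs , y∈ys , refl = cover-member (∈-cartesianProductWith⁺ g x∈xs y∈ys) (f⊑g x y)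

  cartesianProductWith-≈∃ : ∀ {a b c} {A : Set a} {B : Set b} (f g : A → B → Atom c) →
    (∀ x y → f x y ≋ g x y) → (xs : List A) (ys : List B) →
    cartesianProductWith f xs ys ≈∃ cartesianProductWith g xs ys
  cartesianProductWith-≈∃ f g f≋g xs ys =
    cartesianProductWith-≤∃ f g (λ x y → proj₁ (f≋g x y)) xs ys ,
    cartesianProductWith-≤∃ g f (λ x y → proj₂ (f≋g x y)) xs ys

  _∧ᴬ_ : ∀ {c} → Atom c → Atom c → Atom c
  (d , x) ∧ᴬ (e , y) = d ⊗ e , (re (π₁ ×1) x ∧ re (π₂ ×1) y)

  _∧∃_ : ∀ {c} → F∃ c → F∃ c → F∃ c
  _∧∃_ = cartesianProductWith _∧ᴬ_

  _∨∃_ : ∀ {c} → F∃ c → F∃ c → F∃ c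
  _∨∃_ = _++_

  ∧ᴬ-lowerˡ : ∀ {c} (a b : Atom c) → (a ∧ᴬ b) ⊑ a
  ∧ᴬ-lowerˡ a b = π₁ ×1 , π₂-⟨⟩ _ _ , Fibre.x∧y≤x _ _

  ∧ᴬ-lowerʳ : ∀ {c} (a b : Atom c) → (a ∧ᴬ b) ⊑ b
  ∧ᴬ-lowerʳ a b = π₂ ×1 , π₂-⟨⟩ _ _ , Fibre.x∧y≤y _ _

  ∧ᴬ-greatest : ∀ {c d} {x x' : F (d ⊗ c)} {a b : Atom c} → (d , x) ⊑ a → (d , x') ⊑ b →
                (d , (x ∧ x')) ⊑ (a ∧ᴬ b)
  ∧ᴬ-greatest {a = e₁ , y₁} {e₂ , y₂} (r₁ , over₁ , x≤) (r₂ , over₂ , x'≤) =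
    ⟨ ⟨ π₁ ∘ r₁ , π₁ ∘ r₂ ⟩ , π₂ ⟩ , π₂-⟨⟩ _ _ ,
    Fibre.trans (Fibre.∧-monotonic x≤ x'≤) (Fibre.reflexive (begin
      re r₁ y₁ ∧ re r₂ y₂                               ≈⟨ Fibre.∧-cong (re-≡ (sym π₁×1∘r)) (re-≡ (sym π₂×1∘r)) ⟩
      re ((π₁ ×1) ∘ r) y₁ ∧ re ((π₂ ×1) ∘ r) y₂         ≈⟨ Fibre.∧-cong (re-∘ r (π₁ ×1) y₁) (re-∘ r (π₂ ×1) y₂) ⟩
      re r (re (π₁ ×1) y₁) ∧ re r (re (π₂ ×1) y₂)       ≈⟨ re-∧ r _ _ ⟨
      re r (re (π₁ ×1) y₁ ∧ re (π₂ ×1) y₂)              ∎))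
    where
    open ≈-Reasoning
    r = ⟨ ⟨ π₁ ∘ r₁ , π₁ ∘ r₂ ⟩ , π₂ ⟩
    π₁×1∘r : (π₁ ×1) ∘ r ≡ r₁
    π₁×1∘r = trans ×1∘⟨⟩ (trans (cong₂ ⟨_,_⟩ (π₁-⟨⟩ _ _) refl) (over-η over₁))
    π₂×1∘r : (π₂ ×1) ∘ r ≡ r₂
    π₂×1∘r = trans ×1∘⟨⟩ (trans (cong₂ ⟨_,_⟩ (π₂-⟨⟩ _ _) refl) (over-η over₂))

  cover-∧ : ∀ {c d} {xs ys : F∃ c} {x y : F (d ⊗ c)} → Cover xs x → Cover ys y → Cover (xs ∧∃ ys) (x ∧ y)
  cover-∧ {d = d} {xs} {ys} {y = y} cover-x cover-y =
    cover-image (_∧ y) (λ x≤x' → Fibre.∧-monotonic x≤x' Fibre.refl)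
                (λ x x' → Fibre.reflexive (Fibre.∧-distribʳ-∨ y x x')) cover-term-∧ cover-x
    where
    cover-pair : (w : Witness xs d) (v : Witness ys d) → Cover (xs ∧∃ ys) (term w ∧ term v)
    cover-pair (witness _ _ y₁∈xs r₁ over₁) (witness _ _ y₂∈ys r₂ over₂) =
      cover-member (∈-cartesianProductWith⁺ _∧ᴬ_ y₁∈xs y₂∈ys)
                   (∧ᴬ-greatest (r₁ , over₁ , Fibre.refl) (r₂ , over₂ , Fibre.refl))
    cover-term-∧ : (w : Witness xs d) → Cover (xs ∧∃ ys) (term w ∧ y)
    cover-term-∧ w = cover-image (term w ∧_) (Fibre.∧-monotonic Fibre.refl)
                                 (λ y y' → Fibre.reflexive (Fibre.∧-distribˡ-∨ (term w) y y'))
                                 (cover-pair w) cover-y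

  ∨∃-supremum : ∀ {c} (xs ys : F∃ c) →
    (xs ≤∃ (xs ∨∃ ys)) × (ys ≤∃ (xs ∨∃ ys)) × (∀ zs → xs ≤∃ zs → ys ≤∃ zs → (xs ∨∃ ys) ≤∃ zs)
  ∨∃-supremum xs ys = ⊆⇒≤∃ ∈-++⁺ˡ , ⊆⇒≤∃ (∈-++⁺ʳ xs) , λ zs xs≤zs ys≤zs x∈ → [ xs≤zs , ys≤zs ]′ (∈-++⁻ xs x∈)

  ∧∃-infimum : ∀ {c} (xs ys : F∃ c) →
    ((xs ∧∃ ys) ≤∃ xs) × ((xs ∧∃ ys) ≤∃ ys) × (∀ zs → zs ≤∃ xs → zs ≤∃ ys → zs ≤∃ (xs ∧∃ ys))
  ∧∃-infimum xs ys = lowerˡ , lowerʳ , greatest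
    where
    lowerˡ : (xs ∧∃ ys) ≤∃ xs
    lowerˡ a∧b∈ with ∈-cartesianProductWith⁻ _∧ᴬ_ xs ys a∧b∈
    ... | a , b , a∈xs , _ , refl = cover-member a∈xs (∧ᴬ-lowerˡ a b)
    lowerʳ : (xs ∧∃ ys) ≤∃ ys
    lowerʳ a∧b∈ with ∈-cartesianProductWith⁻ _∧ᴬ_ xs ys a∧b∈
    ... | a , b , _ , b∈ys , refl = cover-member b∈ys (∧ᴬ-lowerʳ a b)
    greatest : ∀ zs → zs ≤∃ xs → zs ≤∃ ys → zs ≤∃ (xs ∧∃ ys)
    greatest zs zs≤xs zs≤ys z∈ =
      cover-≤ (Fibre.∧-greatest Fibre.refl Fibre.refl) (cover-∧ (zs≤xs z∈) (zs≤ys z∈))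

  isLattice∃ : ∀ {c} → IsLattice (_≈∃_ {c}) _≤∃_ _∨∃_ _∧∃_
  isLattice∃ {c} = record
    { isPartialOrder = record
      { isPreorder = record
        { isEquivalence = Setoid.isEquivalence (≈∃-setoid c)
        ; reflexive     = proj₁
        ; trans         = ≤∃-trans
        }
      ; antisym = _,_
      }
    ; supremum = ∨∃-supremum
    ; infimum  = ∧∃-infimum
    }

  lattice∃ : Obj → Lattice (o ⊔ p) (o ⊔ h ⊔ p ⊔ ℓ) (o ⊔ h ⊔ p ⊔ ℓ)
  lattice∃ c = record { isLattice = isLattice∃ {c} }

  ∧∃-distribˡ-∨∃ : ∀ {c} (xs ys zs : F∃ c) → (xs ∧∃ (ys ∨∃ zs)) ≈∃ ((xs ∧∃ ys) ∨∃ (xs ∧∃ zs))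
  ∧∃-distribˡ-∨∃ {c} xs ys zs = begin
    xs ∧∃ (ys ++ zs)              ≈⟨ ∧-comm xs (ys ++ zs) ⟩
    (ys ++ zs) ∧∃ xs              ≡⟨ cartesianProductWith-distribʳ-++ _∧ᴬ_ ys zs xs ⟩
    (ys ∧∃ xs) ++ (zs ∧∃ xs)      ≈⟨ ∨-cong (∧-comm ys xs) (∧-comm zs xs) ⟩
    (xs ∧∃ ys) ++ (xs ∧∃ zs)      ∎
    where
    open SetoidReasoning (≈∃-setoid c)
    open MeetSemilatticeProperties (Lattice.meetSemilattice (lattice∃ c)) using (∧-comm)
    open JoinSemilatticeProperties (Lattice.joinSemilattice (lattice∃ c)) using (∨-cong)

  isDistributiveLattice∃ : ∀ {c} → IsDistributiveLattice (_≈∃_ {c}) _≤∃_ _∨∃_ _∧∃_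
  isDistributiveLattice∃ = record { isLattice = isLattice∃ ; ∧-distribˡ-∨ = ∧∃-distribˡ-∨∃ }

  module AtomMap {c c' : Obj} (G : Obj → Obj) (k : ∀ {e} → Hom (G e ⊗ c') (e ⊗ c)) where

    atom : Atom c → Atom c'
    atom (e , y) = G e , re k y

    Liftable : Set (o ⊔ h)
    Liftable = ∀ {e e'} (r : Hom (e ⊗ c) (e' ⊗ c)) → π₂ ∘ r ≡ π₂ →
               Σ[ r' ∈ Hom (G e ⊗ c') (G e' ⊗ c') ] (π₂ ∘ r' ≡ π₂) × (r ∘ k ≡ k ∘ r')

    map-mono : Liftable → ∀ {xs ys} → xs ≤∃ ys → map atom xs ≤∃ map atom ys
    map-mono lift {ys = ys} xs≤ys a∈ with ∈-map⁻ atom a∈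
    ... | (e , y) , y∈xs , refl = cover-image (re k) (re-mono k) (re-∨≤ k) cover-term (xs≤ys y∈xs)
      where
      cover-term : (w : Witness ys e) → Cover (map atom ys) (re k (term w))
      cover-term (witness e' y' y'∈ys r over) with lift r over
      ... | r' , over' , r∘k≡k∘r' =
        cover-member (∈-map⁺ atom y'∈ys) (r' , over' , Fibre.reflexive (re-square r∘k≡k∘r'))

  reindex : ∀ {c c'} → Hom c' c → Atom c → Atom c'
  reindex f = AtomMap.atom (λ e → e) (1× f)

  re∃-mono : ∀ {c c'} (f : Hom c' c) {xs ys : F∃ c} → xs ≤∃ ys → re∃ f xs ≤∃ re∃ f ys
  re∃-mono f = AtomMap.map-mono (λ e → e) (1× f) (λ r over → ⟨ π₁ ∘ (r ∘ (1× f)) , π₂ ⟩ , π₂-⟨⟩ _ _ , 1×-lift over)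

  re∃-cong : ∀ {c c'} (f : Hom c' c) {xs ys : F∃ c} → xs ≈∃ ys → re∃ f xs ≈∃ re∃ f ys
  re∃-cong f (xs≤ys , ys≤xs) = re∃-mono f xs≤ys , re∃-mono f ys≤xs

  reindex-∧ᴬ : ∀ {c c'} (f : Hom c' c) (a b : Atom c) → reindex f (a ∧ᴬ b) ≋ (reindex f a ∧ᴬ reindex f b)
  reindex-∧ᴬ f (d , x) (e , y) =
    ≈⇒≋ (Fibre.Eq.trans (re-∧ (1× f) _ _) (Fibre.∧-cong (re-square ×1-1×-comm) (re-square ×1-1×-comm)))

  reindex-id : ∀ {c} (a : Atom c) → reindex id a ≋ a
  reindex-id (d , x) = ≈⇒≋ (Fibre.Eq.trans (re-≡ 1×-id) (re-id x))

  reindex-∘ : ∀ {a b c} (f : Hom a b) (g : Hom b c) (x : Atom c) → reindex (g ∘ f) x ≋ reindex f (reindex g x)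
  reindex-∘ f g (d , x) = ≈⇒≋ (Fibre.Eq.sym (re-path (1×-∘ g f)))

  re∃-∧ : ∀ {c c'} (f : Hom c' c) (xs ys : F∃ c) → re∃ f (xs ∧∃ ys) ≈∃ (re∃ f xs ∧∃ re∃ f ys)
  re∃-∧ {c} {c'} f xs ys = begin
    map (reindex f) (cartesianProductWith _∧ᴬ_ xs ys)
      ≡⟨ map-cartesianProductWith (reindex f) _∧ᴬ_ xs ys ⟩
    cartesianProductWith (λ a b → reindex f (a ∧ᴬ b)) xs ys
      ≈⟨ cartesianProductWith-≈∃ _ _ (reindex-∧ᴬ f) xs ys ⟩
    cartesianProductWith (λ a b → reindex f a ∧ᴬ reindex f b) xs ys
      ≡⟨ cartesianProductWith-mapʳ _ (reindex f) xs ys ⟨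
    cartesianProductWith (λ a → reindex f a ∧ᴬ_) xs (map (reindex f) ys)
      ≡⟨ cartesianProductWith-mapˡ _∧ᴬ_ (reindex f) xs (map (reindex f) ys) ⟨
    cartesianProductWith _∧ᴬ_ (map (reindex f) xs) (map (reindex f) ys) ∎
    where open SetoidReasoning (≈∃-setoid c')

  re∃-id : ∀ {c} (xs : F∃ c) → re∃ id xs ≈∃ xs
  re∃-id {c} xs = begin
    map (reindex id) xs  ≈⟨ map-≈∃ _ _ reindex-id xs ⟩
    map (λ a → a) xs     ≡⟨ map-id xs ⟩
    xs                   ∎
    where open SetoidReasoning (≈∃-setoid c)

  re∃-∘ : ∀ {a b c} (f : Hom a b) (g : Hom b c) (xs : F∃ c) → re∃ (g ∘ f) xs ≈∃ re∃ f (re∃ g xs)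
  re∃-∘ {a} f g xs = begin
    map (reindex (g ∘ f)) xs              ≈⟨ map-≈∃ _ _ (reindex-∘ f g) xs ⟩
    map (λ x → reindex f (reindex g x)) xs ≡⟨ map-∘ xs ⟩
    map (reindex f) (map (reindex g) xs)  ∎
    where open SetoidReasoning (≈∃-setoid a)

  isDoctrine∃ : IsDoctrine C FP F∃ _≈∃_ _≤∃_ re∃
  isDoctrine∃ = record
    { _∨_                   = _∨∃_
    ; _∧_                   = _∧∃_
    ; isDistributiveLattice = isDistributiveLattice∃
    ; re-cong               = re∃-cong
    ; re-∨                  = λ f xs ys → Setoid.reflexive (≈∃-setoid _) (map-++ (reindex f) xs ys)
    ; re-∧                  = re∃-∧
    ; re-id                 = re∃-id
    ; re-∘                  = re∃-∘
    }

  quantify : ∀ d {c} → Atom (d ⊗ c) → Atom c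
  quantify d = AtomMap.atom (_⊗ d) assocˡ

  Σ∃ : ∀ d {c} → F∃ (d ⊗ c) → F∃ c
  Σ∃ d = map (quantify d)

  Σ∃-mono : ∀ d {c} {ys zs : F∃ (d ⊗ c)} → ys ≤∃ zs → Σ∃ d ys ≤∃ Σ∃ d zs
  Σ∃-mono d = AtomMap.map-mono (_⊗ d) assocˡ
    (λ r over → assocʳ ∘ (r ∘ assocˡ) , assoc-conjugate-over over , sym (cancelˡ assocˡ∘assocʳ))

  quantify-unit : ∀ d {c} (a : Atom (d ⊗ c)) → a ⊑ reindex π₂ (quantify d a)
  quantify-unit d (e , y) = ⟨ ⟨ π₁ , π₁ ∘ π₂ ⟩ , π₂ ⟩ , π₂-⟨⟩ _ _ , Fibre.reflexive (begin
    y                                                            ≈⟨ re-id y ⟨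
    re id y                                                      ≈⟨ re-path assocˡ∘assocʳ ⟨
    re assocʳ (re assocˡ y)                                      ≈⟨ re-path 1×∘⟨⟩ ⟨
    re ⟨ ⟨ π₁ , π₁ ∘ π₂ ⟩ , π₂ ⟩ (re (1× π₂) (re assocˡ y))      ∎)
    where open ≈-Reasoning

  quantify-counit : ∀ d {c} (a : Atom c) → quantify d (reindex π₂ a) ⊑ a
  quantify-counit d (e , x) = π₁ ×1 , π₂-⟨⟩ _ _ , Fibre.reflexive (re-path 1×π₂∘assocˡ)

  Σ∃-unit : ∀ d {c} (ys : F∃ (d ⊗ c)) → ys ≤∃ re∃ π₂ (Σ∃ d ys)
  Σ∃-unit d {c} ys = begin
    ys                                              ≡⟨ map-id ys ⟨
    map (λ a → a) ys                                ≤⟨ map-≤∃ _ _ (quantify-unit d) ys ⟩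
    map (λ a → reindex π₂ (quantify d a)) ys        ≡⟨ map-∘ ys ⟩
    map (reindex π₂) (map (quantify d) ys)          ∎
    where open PartialOrderReasoning (Lattice.poset (lattice∃ (d ⊗ c)))

  Σ∃-counit : ∀ d {c} (xs : F∃ c) → Σ∃ d (re∃ π₂ xs) ≤∃ xs
  Σ∃-counit d {c} xs = begin
    map (quantify d) (map (reindex π₂) xs)          ≡⟨ map-∘ xs ⟨
    map (λ a → quantify d (reindex π₂ a)) xs        ≤⟨ map-≤∃ _ _ (quantify-counit d) xs ⟩
    map (λ a → a) xs                                ≡⟨ map-id xs ⟩
    xs                                              ∎
    where open PartialOrderReasoning (Lattice.poset (lattice∃ c))

  Σ∃⊣re∃ : ∀ d {c} (ys : F∃ (d ⊗ c)) (xs : F∃ c) →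
           (Σ∃ d ys ≤∃ xs → ys ≤∃ re∃ π₂ xs) × (ys ≤∃ re∃ π₂ xs → Σ∃ d ys ≤∃ xs)
  Σ∃⊣re∃ d ys xs = (λ Σys≤xs → ≤∃-trans (Σ∃-unit d ys) (re∃-mono π₂ Σys≤xs))
                 , (λ ys≤π*xs → ≤∃-trans (Σ∃-mono d ys≤π*xs) (Σ∃-counit d xs))

  quantify-beck-chevalley : ∀ d {c c'} (f : Hom c' c) (a : Atom (d ⊗ c)) →
                            reindex f (quantify d a) ≋ quantify d (reindex (1× f) a)
  quantify-beck-chevalley d f (e , y) = ≈⇒≋ (re-square assocˡ∘1×)

  Σ∃-beck-chevalley : ∀ d {c c'} (f : Hom c' c) (ys : F∃ (d ⊗ c)) →
                      re∃ f (Σ∃ d ys) ≈∃ Σ∃ d (re∃ (1× f) ys)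
  Σ∃-beck-chevalley d {c' = c'} f ys = begin
    map (reindex f) (map (quantify d) ys)           ≡⟨ map-∘ ys ⟨
    map (λ a → reindex f (quantify d a)) ys         ≈⟨ map-≈∃ _ _ (quantify-beck-chevalley d f) ys ⟩
    map (λ a → quantify d (reindex (1× f) a)) ys    ≡⟨ map-∘ ys ⟩
    map (quantify d) (map (reindex (1× f)) ys)      ∎
    where open SetoidReasoning (≈∃-setoid c')

  quantify-frobenius : ∀ d {c} (a : Atom c) (b : Atom (d ⊗ c)) →
                       (a ∧ᴬ quantify d b) ⊑ quantify d (reindex π₂ a ∧ᴬ b)
  quantify-frobenius d (d₁ , x) (e , y) = assocʳ ×1 , π₂-⟨⟩ _ _ , Fibre.reflexive (begin
    re (π₁ ×1) x ∧ re (π₂ ×1) (re assocˡ y)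
      ≈⟨ Fibre.∧-cong (re-path 1×π₂∘π₁×1∘assocˡ∘assocʳ×1) (re-square π₂×1∘assocˡ∘assocʳ×1) ⟨
    re ρ (re ((1× π₂) ∘ (π₁ ×1)) x) ∧ re ρ (re (π₂ ×1) y)
      ≈⟨ Fibre.∧-cong (re-cong ρ (re-path refl)) Fibre.Eq.refl ⟨
    re ρ (re (π₁ ×1) (re (1× π₂) x)) ∧ re ρ (re (π₂ ×1) y)
      ≈⟨ re-∧ ρ _ _ ⟨
    re ρ (re (π₁ ×1) (re (1× π₂) x) ∧ re (π₂ ×1) y)
      ≈⟨ re-path refl ⟨
    re (assocʳ ×1) (re assocˡ (re (π₁ ×1) (re (1× π₂) x) ∧ re (π₂ ×1) y)) ∎)
    where
    open ≈-Reasoning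
    ρ = assocˡ ∘ (assocʳ ×1)

  Σ∃-frobenius : ∀ d {c} (xs : F∃ c) (ys : F∃ (d ⊗ c)) → (xs ∧∃ Σ∃ d ys) ≈∃ Σ∃ d (re∃ π₂ xs ∧∃ ys)
  Σ∃-frobenius d {c} xs ys = ≤-pointwise , ≥-adjoint
    where
    open PartialOrderReasoning (Lattice.poset (lattice∃ c))
    open Lattice (lattice∃ c) using (∧-greatest)
    open Lattice (lattice∃ (d ⊗ c)) using (x∧y≤x; x∧y≤y)
    ≤-pointwise : (xs ∧∃ Σ∃ d ys) ≤∃ Σ∃ d (re∃ π₂ xs ∧∃ ys)
    ≤-pointwise = begin
      cartesianProductWith _∧ᴬ_ xs (map (quantify d) ys)
        ≡⟨ cartesianProductWith-mapʳ _∧ᴬ_ (quantify d) xs ys ⟩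
      cartesianProductWith (λ a b → a ∧ᴬ quantify d b) xs ys
        ≤⟨ cartesianProductWith-≤∃ _ _ (quantify-frobenius d) xs ys ⟩
      cartesianProductWith (λ a b → quantify d (reindex π₂ a ∧ᴬ b)) xs ys
        ≡⟨ map-cartesianProductWith (quantify d) (λ a → reindex π₂ a ∧ᴬ_) xs ys ⟨
      map (quantify d) (cartesianProductWith (λ a → reindex π₂ a ∧ᴬ_) xs ys)
        ≡⟨ cong (map (quantify d)) (cartesianProductWith-mapˡ _∧ᴬ_ (reindex π₂) xs ys) ⟨
      map (quantify d) (cartesianProductWith _∧ᴬ_ (map (reindex π₂) xs) ys) ∎
    ≥-adjoint : Σ∃ d (re∃ π₂ xs ∧∃ ys) ≤∃ (xs ∧∃ Σ∃ d ys)
    ≥-adjoint = ∧-greatest (proj₂ (Σ∃⊣re∃ d _ xs) (x∧y≤x (re∃ π₂ xs) ys)) (Σ∃-mono d (x∧y≤y (re∃ π₂ xs) ys))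

  isExistential∃ : IsExistential C FP isDoctrine∃
  isExistential∃ = record
    { Σᵈ             = Σ∃
    ; adjunction     = Σ∃⊣re∃
    ; frobenius      = Σ∃-frobenius
    ; beck-chevalley = Σ∃-beck-chevalley
    }

corollary4p5 : ∀ {o h p ℓ : Level} (C : Category o h) (FP : FiniteProducts C)
                 (P : Doctrine C FP p ℓ) →
                 let open Completion C FP P in
                 Σ[ D ∈ IsDoctrine C FP F∃ _≈∃_ _≤∃_ re∃ ] IsExistential C FP D
corollary4p5 C FP P = isDoctrine∃ , isExistential∃
  where open ExistentialCompletion C FP P
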